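{- For every set $\Gamma\cup\{\alpha\}$ of formulas over $\{\wedge,\vee,\to,\neg,\copyright\}$: $\Gamma\vdash_{{\sf HBD2}_T}\alpha$ if and only if $\Gamma\models^{T}_{\sf BD2}\alpha$.
   Context: Formulas are built from propositional variables with binary $\wedge,\vee,\to$ and unary $\neg,\copyright$; $\alpha\leftrightarrow\beta$ abbreviates $(\alpha\to\beta)\wedge(\beta\to\alpha)$. The Hilbert calculus ${\sf HBD2}_T$ has modus ponens as its only rule and the axiom schemas: (P1) $\alpha\to(\beta\to\alpha)$; (P2) $(\alpha\to(\beta\to\gamma))\to((\alpha\to\beta)\to(\alpha\to\gamma))$; (P3) $\alpha\wedge\beta\to\alpha$; (P4) $\alpha\wedge\beta\to\beta$; (P5) $\alpha\to(\beta\to(\alpha\wedge\beta))$; (P6) $\alpha\to(\alpha\vee\beta)$; (P7) $\alpha\to(\beta\vee\alpha)$; (P8) $(\alpha\to\gamma)\to((\beta\to\gamma)\to(\alpha\vee\beta\to\gamma))$; (P9) $\alpha\vee(\alpha\to\beta)$; (DNeg) $\neg\neg\alpha\leftrightarrow\alpha$; (DM1) $\neg(\alpha\vee\beta)\leftrightarrow(\neg\alpha\wedge\neg\beta)$; (DM2) $\neg(\alpha\wedge\beta)\leftrightarrow(\neg\alpha\vee\neg\beta)$; (DM3) $\neg(\alpha\to\beta)\leftrightarrow((\neg\alpha\to\alpha)\wedge\neg\beta)$; (©1) $(\copyright\alpha\wedge(\alpha\wedge\neg\alpha))\to\beta$; (©2) $\copyright\alpha\vee(\alpha\wedge\neg\alpha)$;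 (©3) $\neg\copyright\alpha\leftrightarrow(\alpha\leftrightarrow\neg\alpha)$. Twist semantics: for a Boolean algebra ${\bf A}$ (meet $\sqcap$, join $\sqcup$, complement $\sim$, top $1$, $a\Rightarrow b=\sim a\sqcup b$, $a\Leftrightarrow b=(a\Rightarrow b)\sqcap(b\Rightarrow a)$), the twist structure $\mathcal T_{\bf A}$ has domain $A\times A$ with $\tilde\neg(a,b)=(b,a)$, $(a,b)\tilde\wedge(c,d)=(a\sqcap c,b\sqcup d)$, $(a,b)\tilde\vee(c,d)=(a\sqcup c,b\sqcap d)$, $(a,b)\tilde\to(c,d)=(a\Rightarrow c,(b\Rightarrow a)\sqcap d)$, $\tilde\copyright(a,b)=(\sim(a\sqcap b),a\Leftrightarrow b)$; designated set $D_{\bf A}=\{(1,a):a\in A\}$. $\Gamma\models^T_{\bf A}\varphi$ iff every homomorphism $v$ from formulas into $\mathcal T_{\bf A}$ with $v[\Gamma]\subseteq D_{\bf A}$ has $v(\varphi)\in D_{\bf A}$; $\Gamma\models^T_{\sf BD2}\varphi$ iff $\Gamma\models^T_{\bf A}\varphi$ for every Boolean algebra ${\bf A}$. -}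

module Defs where

open import Level using (Level; _⊔_) renaming (suc to lsuc; zero to 0ℓ)
open import Data.Nat using (ℕ)
open import Data.Product using (_×_; _,_; proj₁; proj₂)
open import Algebra.Lattice.Bundles using (BooleanAlgebra)

infixr 5 _→̇_
infixr 6 _∨̇_
infixr 7 _∧̇_
infix  8 ¬̇_ ©_
data Formula : Set where
  var  : ℕ → Formula
  _∧̇_  : Formula → Formula → Formula
  _∨̇_  : Formula → Formula → Formula
  _→̇_  : Formula → Formula → Formula
  ¬̇_   : Formula → Formula
  ©_   : Formula → Formula

_↔̇_ : Formula → Formula → Formula
α ↔̇ β = (α →̇ β) ∧̇ (β →̇ α)

data Axiom : Formula → Set where
  P1   : ∀ α β → Axiom (α →̇ (β →̇ α))
  P2   : ∀ α β γ → Axiom ((α →̇ (β →̇ γ)) →̇ ((α →̇ β) →̇ (α →̇ γ)))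
  P3   : ∀ α β → Axiom ((α ∧̇ β) →̇ α)
  P4   : ∀ α β → Axiom ((α ∧̇ β) →̇ β)
  P5   : ∀ α β → Axiom (α →̇ (β →̇ (α ∧̇ β)))
  P6   : ∀ α β → Axiom (α →̇ (α ∨̇ β))
  P7   : ∀ α β → Axiom (α →̇ (β ∨̇ α))
  P8   : ∀ α β γ → Axiom ((α →̇ γ) →̇ ((β →̇ γ) →̇ ((α ∨̇ β) →̇ γ)))
  P9   : ∀ α β → Axiom (α ∨̇ (α →̇ β))
  DNeg : ∀ α → Axiom ((¬̇ ¬̇ α) ↔̇ α)
  DM1  : ∀ α β → Axiom ((¬̇ (α ∨̇ β)) ↔̇ ((¬̇ α) ∧̇ (¬̇ β)))
  DM2  : ∀ α β → Axiom ((¬̇ (α ∧̇ β)) ↔̇ ((¬̇ α) ∨̇ (¬̇ β)))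
  DM3  : ∀ α β → Axiom ((¬̇ (α →̇ β)) ↔̇ (((¬̇ α) →̇ α) ∧̇ (¬̇ β)))
  C1   : ∀ α β → Axiom (((© α) ∧̇ (α ∧̇ (¬̇ α))) →̇ β)
  C2   : ∀ α → Axiom ((© α) ∨̇ (α ∧̇ (¬̇ α)))
  C3   : ∀ α → Axiom ((¬̇ (© α)) ↔̇ (α ↔̇ (¬̇ α)))

FormulaSet : Set₁
FormulaSet = Formula → Set

infix 3 _⊢_
data _⊢_ (Γ : FormulaSet) : Formula → Set where
  hyp : ∀ {α} → Γ α → Γ ⊢ α
  ax  : ∀ {α} → Axiom α → Γ ⊢ α
  mp  : ∀ {α β} → Γ ⊢ α → Γ ⊢ (α →̇ β) → Γ ⊢ β

module Twist {c ℓ : Level} (B : BooleanAlgebra c ℓ) where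
  open BooleanAlgebra B

  T : Set c
  T = Carrier × Carrier

  _⇒_ : Carrier → Carrier → Carrier
  a ⇒ b = (¬ a) ∨ b

  _⇔_ : Carrier → Carrier → Carrier
  a ⇔ b = (a ⇒ b) ∧ (b ⇒ a)

  ~¬ : T → T
  ~¬ (a , b) = (b , a)

  _~∧_ : T → T → T
  (a , b) ~∧ (c , d) = (a ∧ c , b ∨ d)

  _~∨_ : T → T → T
  (a , b) ~∨ (c , d) = (a ∨ c , b ∧ d)

  _~→_ : T → T → T
  (a , b) ~→ (c , d) = (a ⇒ c , (b ⇒ a) ∧ d)

  ~© : T → T
  ~© (a , b) = (¬ (a ∧ b) , a ⇔ b)

  -- Designated set D_A = {(1 , a) : a ∈ A}  (up to the algebra's equality)
  Designated : T → Set ℓ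
  Designated x = proj₁ x ≈ ⊤

  -- Homomorphisms from the formula algebra into T_A are exactly the
  -- unique extensions of assignments of the variables.
  ⟦_⟧ : Formula → (ℕ → T) → T
  ⟦ var n ⟧ ρ = ρ n
  ⟦ φ ∧̇ ψ ⟧ ρ = ⟦ φ ⟧ ρ ~∧ ⟦ ψ ⟧ ρ
  ⟦ φ ∨̇ ψ ⟧ ρ = ⟦ φ ⟧ ρ ~∨ ⟦ ψ ⟧ ρ
  ⟦ φ →̇ ψ ⟧ ρ = ⟦ φ ⟧ ρ ~→ ⟦ ψ ⟧ ρ
  ⟦ ¬̇ φ ⟧ ρ = ~¬ (⟦ φ ⟧ ρ)
  ⟦ © φ ⟧ ρ = ~© (⟦ φ ⟧ ρ)

  _⊨_ : FormulaSet → Formula → Set (c ⊔ ℓ)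
  Γ ⊨ φ = (ρ : ℕ → T) → (∀ ψ → Γ ψ → Designated (⟦ ψ ⟧ ρ)) → Designated (⟦ φ ⟧ ρ)

_⊨BD2[_,_]_ : FormulaSet → (c ℓ : Level) → Formula → Set (lsuc (c ⊔ ℓ))
Γ ⊨BD2[ c , ℓ ] φ = (B : BooleanAlgebra c ℓ) → Twist._⊨_ B Γ φ

-- In 𝒯_A a value is designated iff its first component is ⊤, and the first
-- component of ⟦φ⟧ is computed by the Boolean operations ∧, ∨, ⇒ of A (plus
-- ¬(a ∧ b) for ©). Every axiom is therefore designated: the positive ones are
-- Boolean tautologies, and in each of DNeg, DM1–3 and ©3 both sides of the ↔
-- denote the same element of 𝒯_A. Modus ponens preserves ⊤, giving soundness.
--
-- For completeness take the Lindenbaum algebra of Γ: formulas modulo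
-- interderivability form a Boolean algebra under ∧, ∨, → with falsum
-- ©p ∧ (p ∧ ¬p), which is explosive by ©1, and complement a → falsum. The
-- valuation p ↦ (p , ¬p) then sends every φ to (φ , ¬φ) up to
-- interderivability; this is exactly what DNeg, DM1–3 and ©1–3 say. So if
-- Γ ⊨ α over this algebra, the first component α of ⟦α⟧ is interderivable
-- with ⊤, i.e. Γ ⊢ α.

module Submission where

open import Defs
open import Level using (Level; 0ℓ; _⊔_; Lift; lift; lower)
open import Data.Nat using (ℕ)
open import Data.Product using (_×_; _,_; proj₁; proj₂)
open import Data.Sum using (_⊎_; inj₁; inj₂)
open import Relation.Binary.PropositionalEquality using (_≡_; refl)
open import Relation.Binary.Bundles using (Poset)
open import Algebra.Lattice.Bundles using (BooleanAlgebra)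
open import Algebra.Lattice.Structures using (IsBooleanAlgebra)
open import Algebra.Lattice.Structures.Biased
  using (isDistributiveLatticeʳʲᵐ; isBooleanAlgebraʳ)
import Algebra.Lattice.Properties.BooleanAlgebra as BooleanAlgebraProperties
import Relation.Binary.Lattice.Structures as OrderLattice
import Relation.Binary.Reasoning.Setoid as SetoidReasoning

module Soundness {c ℓ : Level} (B : BooleanAlgebra c ℓ) where
  open BooleanAlgebra B
  open BooleanAlgebraProperties B
  open Twist B using (_⇒_; ⟦_⟧; Designated; _⊨_)
  open SetoidReasoning setoid
  open Poset poset using (_≤_)
    renaming (refl to ≤-refl; trans to ≤-trans; reflexive to ≤-reflexive)
  open OrderLattice.IsLattice ∨-∧-isOrderTheoreticLattice
    using (x≤x∨y; y≤x∨y; ∨-least; x∧y≤x; x∧y≤y; ∧-greatest)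

  x∧[x⇒y]≈x∧y : ∀ x y → x ∧ (x ⇒ y) ≈ x ∧ y
  x∧[x⇒y]≈x∧y x y = begin
    x ∧ (¬ x ∨ y)        ≈⟨ ∧-distribˡ-∨ x (¬ x) y ⟩
    (x ∧ ¬ x) ∨ (x ∧ y)  ≈⟨ ∨-congʳ (∧-complementʳ x) ⟩
    ⊥ ∨ (x ∧ y)          ≈⟨ ∨-identityˡ (x ∧ y) ⟩
    x ∧ y                ∎

  x∧[x⇒y]≤y : ∀ x y → x ∧ (x ⇒ y) ≤ y
  x∧[x⇒y]≤y x y = ≤-trans (≤-reflexive (x∧[x⇒y]≈x∧y x y)) (x∧y≤y x y)

  ≤-to-⇒≈⊤ : ∀ {x y} → x ≤ y → x ⇒ y ≈ ⊤
  ≤-to-⇒≈⊤ {x} {y} x≤y = begin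
    ¬ x ∨ y                ≈⟨ sym (∧-identityˡ _) ⟩
    ⊤ ∧ (¬ x ∨ y)          ≈⟨ ∧-congʳ (sym (∨-complementˡ x)) ⟩
    (¬ x ∨ x) ∧ (¬ x ∨ y)  ≈⟨ sym (∨-distribˡ-∧ (¬ x) x y) ⟩
    ¬ x ∨ (x ∧ y)          ≈⟨ ∨-congˡ (sym x≤y) ⟩
    ¬ x ∨ x                ≈⟨ ∨-complementˡ x ⟩
    ⊤                      ∎

  ⇒≈⊤-to-≤ : ∀ {x y} → x ⇒ y ≈ ⊤ → x ≤ y
  ⇒≈⊤-to-≤ {x} {y} x⇒y≈⊤ = begin
    x            ≈⟨ sym (∧-identityʳ x) ⟩
    x ∧ ⊤        ≈⟨ ∧-congˡ (sym x⇒y≈⊤) ⟩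
    x ∧ (x ⇒ y)  ≈⟨ x∧[x⇒y]≈x∧y x y ⟩
    x ∧ y        ∎

  ⇒-modusPonens : ∀ {x y} → x ≈ ⊤ → x ⇒ y ≈ ⊤ → y ≈ ⊤
  ⇒-modusPonens {x} {y} x≈⊤ x⇒y≈⊤ = begin
    y      ≈⟨ sym (∧-identityˡ y) ⟩
    ⊤ ∧ y  ≈⟨ ∧-congʳ (sym x≈⊤) ⟩
    x ∧ y  ≈⟨ sym (⇒≈⊤-to-≤ x⇒y≈⊤) ⟩
    x      ≈⟨ x≈⊤ ⟩
    ⊤      ∎

  ⇒-curry : ∀ x y z → x ⇒ (y ⇒ z) ≈ (x ∧ y) ⇒ z
  ⇒-curry x y z = begin
    ¬ x ∨ (¬ y ∨ z)  ≈⟨ sym (∨-assoc _ _ _) ⟩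
    (¬ x ∨ ¬ y) ∨ z  ≈⟨ ∨-congʳ (sym (deMorgan₁ x y)) ⟩
    ¬ (x ∧ y) ∨ z    ∎

  ≤-to-⇒₂≈⊤ : ∀ {x y z} → x ∧ y ≤ z → x ⇒ (y ⇒ z) ≈ ⊤
  ≤-to-⇒₂≈⊤ x∧y≤z = trans (⇒-curry _ _ _) (≤-to-⇒≈⊤ x∧y≤z)

  ≤-to-⇒₃≈⊤ : ∀ {w x y z} → w ∧ (x ∧ y) ≤ z → w ⇒ (x ⇒ (y ⇒ z)) ≈ ⊤
  ≤-to-⇒₃≈⊤ w∧x∧y≤z = trans (∨-congˡ (⇒-curry _ _ _)) (≤-to-⇒₂≈⊤ w∧x∧y≤z)

  ⇒-distrib-≤ : ∀ x y z → (x ⇒ (y ⇒ z)) ∧ ((x ⇒ y) ∧ x) ≤ z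
  ⇒-distrib-≤ x y z = ≤-trans (∧-greatest w≤y w≤y⇒z) (x∧[x⇒y]≤y y z)
    where
      w = (x ⇒ (y ⇒ z)) ∧ ((x ⇒ y) ∧ x)
      w≤x : w ≤ x
      w≤x = ≤-trans (x∧y≤y _ _) (x∧y≤y _ _)
      w≤y : w ≤ y
      w≤y = ≤-trans (∧-greatest w≤x (≤-trans (x∧y≤y _ _) (x∧y≤x _ _))) (x∧[x⇒y]≤y x y)
      w≤y⇒z : w ≤ y ⇒ z
      w≤y⇒z = ≤-trans (∧-greatest w≤x (x∧y≤x _ _)) (x∧[x⇒y]≤y x (y ⇒ z))

  ⇒-cases-≤ : ∀ x y z → (x ⇒ z) ∧ ((y ⇒ z) ∧ (x ∨ y)) ≤ z
  ⇒-cases-≤ x y z = ≤-trans (≤-reflexive split) (∨-least (case (x∧y≤x _ _)) (case (x∧y≤y _ _)))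
    where
      h = (x ⇒ z) ∧ (y ⇒ z)
      split : (x ⇒ z) ∧ ((y ⇒ z) ∧ (x ∨ y)) ≈ (h ∧ x) ∨ (h ∧ y)
      split = trans (sym (∧-assoc _ _ _)) (∧-distribˡ-∨ _ _ _)
      case : ∀ {u} → h ≤ u ⇒ z → h ∧ u ≤ z
      case {u} h≤u⇒z = ≤-trans (∧-greatest (x∧y≤y _ _) (≤-trans (x∧y≤x _ _) h≤u⇒z)) (x∧[x⇒y]≤y u z)

  ⇔-refl-≈⊤ : ∀ x → (x ⇒ x) ∧ (x ⇒ x) ≈ ⊤
  ⇔-refl-≈⊤ x = trans (∧-cong (≤-to-⇒≈⊤ ≤-refl) (≤-to-⇒≈⊤ ≤-refl)) (∧-identityˡ ⊤)

  axiom-designated : ∀ {φ} → Axiom φ → ∀ ρ → Designated (⟦ φ ⟧ ρ)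
  axiom-designated (P1 α β) ρ = ≤-to-⇒₂≈⊤ (x∧y≤x _ _)
  axiom-designated (P2 α β γ) ρ = ≤-to-⇒₃≈⊤ (⇒-distrib-≤ _ _ _)
  axiom-designated (P3 α β) ρ = ≤-to-⇒≈⊤ (x∧y≤x _ _)
  axiom-designated (P4 α β) ρ = ≤-to-⇒≈⊤ (x∧y≤y _ _)
  axiom-designated (P5 α β) ρ = ≤-to-⇒₂≈⊤ ≤-refl
  axiom-designated (P6 α β) ρ = ≤-to-⇒≈⊤ (x≤x∨y _ _)
  axiom-designated (P7 α β) ρ = ≤-to-⇒≈⊤ (y≤x∨y _ _)
  axiom-designated (P8 α β γ) ρ = ≤-to-⇒₃≈⊤ (⇒-cases-≤ _ _ _)
  axiom-designated (P9 α β) ρ = begin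
    a ∨ (¬ a ∨ b)  ≈⟨ sym (∨-assoc _ _ _) ⟩
    (a ∨ ¬ a) ∨ b  ≈⟨ ∨-congʳ (∨-complementʳ a) ⟩
    ⊤ ∨ b          ≈⟨ ∨-zeroˡ b ⟩
    ⊤              ∎
    where
      a = proj₁ (⟦ α ⟧ ρ)
      b = proj₁ (⟦ β ⟧ ρ)
  axiom-designated (DNeg α) ρ = ⇔-refl-≈⊤ _
  axiom-designated (DM1 α β) ρ = ⇔-refl-≈⊤ _
  axiom-designated (DM2 α β) ρ = ⇔-refl-≈⊤ _
  axiom-designated (DM3 α β) ρ = ⇔-refl-≈⊤ _
  axiom-designated (C1 α β) ρ =
    ≤-to-⇒≈⊤ (≤-trans (≤-reflexive (∧-complementˡ _)) (sym (∧-zeroˡ _)))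
  axiom-designated (C2 α) ρ = ∨-complementˡ _
  axiom-designated (C3 α) ρ = ⇔-refl-≈⊤ _

  sound : ∀ {Γ α} → Γ ⊢ α → Γ ⊨ α
  sound (hyp α∈Γ) ρ ρ⊨Γ = ρ⊨Γ _ α∈Γ
  sound (ax axiom) ρ ρ⊨Γ = axiom-designated axiom ρ
  sound (mp ⊢α ⊢α→β) ρ ρ⊨Γ = ⇒-modusPonens (sound ⊢α ρ ρ⊨Γ) (sound ⊢α→β ρ ρ⊨Γ)

module _ {a b} (c ℓ : Level) (B : BooleanAlgebra a b) where
  open BooleanAlgebra B renaming (refl to ≈-refl)

  liftBooleanAlgebra : BooleanAlgebra (a ⊔ c) (b ⊔ ℓ)
  liftBooleanAlgebra = record
    { Carrier = Lift c Carrier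
    ; _≈_ = λ x y → Lift ℓ (lower x ≈ lower y)
    ; _∨_ = λ x y → lift (lower x ∨ lower y)
    ; _∧_ = λ x y → lift (lower x ∧ lower y)
    ; ¬_ = λ x → lift (¬ lower x)
    ; ⊤ = lift ⊤
    ; ⊥ = lift ⊥
    ; isBooleanAlgebra = record
      { isDistributiveLattice = record
        { isLattice = record
          { isEquivalence = record
            { refl = lift ≈-refl
            ; sym = λ p → lift (sym (lower p))
            ; trans = λ p q → lift (trans (lower p) (lower q))
            }
          ; ∨-comm = λ _ _ → lift (∨-comm _ _)
          ; ∨-assoc = λ _ _ _ → lift (∨-assoc _ _ _)
          ; ∨-cong = λ p q → lift (∨-cong (lower p) (lower q))
          ; ∧-comm = λ _ _ → lift (∧-comm _ _)
          ; ∧-assoc = λ _ _ _ → lift (∧-assoc _ _ _)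
          ; ∧-cong = λ p q → lift (∧-cong (lower p) (lower q))
          ; absorptive = (λ _ _ → lift (∨-absorbs-∧ _ _)) , (λ _ _ → lift (∧-absorbs-∨ _ _))
          }
        ; ∨-distrib-∧ = (λ _ _ _ → lift (∨-distribˡ-∧ _ _ _)) , (λ _ _ _ → lift (∨-distribʳ-∧ _ _ _))
        ; ∧-distrib-∨ = (λ _ _ _ → lift (∧-distribˡ-∨ _ _ _)) , (λ _ _ _ → lift (∧-distribʳ-∨ _ _ _))
        }
      ; ∨-complement = (λ _ → lift (∨-complementˡ _)) , (λ _ → lift (∨-complementʳ _))
      ; ∧-complement = (λ _ → lift (∧-complementˡ _)) , (λ _ → lift (∧-complementʳ _))
      ; ¬-cong = λ p → lift (¬-cong (lower p))
      }
    }

infixl 4 _,,_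
_,,_ : FormulaSet → Formula → FormulaSet
(Γ ,, φ) ψ = Γ ψ ⊎ ψ ≡ φ

module _ {Γ : FormulaSet} where

  →-refl : ∀ φ → Γ ⊢ φ →̇ φ
  →-refl φ = mp (ax (P1 φ φ)) (mp (ax (P1 φ (φ →̇ φ))) (ax (P2 φ (φ →̇ φ) φ)))

  weaken : ∀ {φ α} → Γ ⊢ α → Γ ,, φ ⊢ α
  weaken (hyp α∈Γ) = hyp (inj₁ α∈Γ)
  weaken (ax axiom) = ax axiom
  weaken (mp ⊢α ⊢α→β) = mp (weaken ⊢α) (weaken ⊢α→β)

  deduction : ∀ {φ ψ} → Γ ,, φ ⊢ ψ → Γ ⊢ φ →̇ ψ
  deduction (hyp (inj₁ ψ∈Γ)) = mp (hyp ψ∈Γ) (ax (P1 _ _))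
  deduction (hyp (inj₂ refl)) = →-refl _
  deduction (ax axiom) = mp (ax axiom) (ax (P1 _ _))
  deduction (mp ⊢α ⊢α→β) = mp (deduction ⊢α) (mp (deduction ⊢α→β) (ax (P2 _ _ _)))

  →-elim : ∀ {α β} → Γ ⊢ α →̇ β → Γ ⊢ α → Γ ⊢ β
  →-elim ⊢α→β ⊢α = mp ⊢α ⊢α→β

  ∧-intro : ∀ {α β} → Γ ⊢ α → Γ ⊢ β → Γ ⊢ α ∧̇ β
  ∧-intro ⊢α ⊢β = mp ⊢β (mp ⊢α (ax (P5 _ _)))

  ∧-elimˡ : ∀ {α β} → Γ ⊢ α ∧̇ β → Γ ⊢ α
  ∧-elimˡ ⊢α∧β = mp ⊢α∧β (ax (P3 _ _))

  ∧-elimʳ : ∀ {α β} → Γ ⊢ α ∧̇ β → Γ ⊢ β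
  ∧-elimʳ ⊢α∧β = mp ⊢α∧β (ax (P4 _ _))

  ∨-introˡ : ∀ {α} β → Γ ⊢ α → Γ ⊢ α ∨̇ β
  ∨-introˡ β ⊢α = mp ⊢α (ax (P6 _ β))

  ∨-introʳ : ∀ α {β} → Γ ⊢ β → Γ ⊢ α ∨̇ β
  ∨-introʳ α ⊢β = mp ⊢β (ax (P7 _ α))

  ∨-elim : ∀ {α β γ} → Γ ⊢ α ∨̇ β → Γ ,, α ⊢ γ → Γ ,, β ⊢ γ → Γ ⊢ γ
  ∨-elim ⊢α∨β α⊢γ β⊢γ = mp ⊢α∨β (mp (deduction β⊢γ) (mp (deduction α⊢γ) (ax (P8 _ _ _))))

  assumption₀ : ∀ {φ} → Γ ,, φ ⊢ φ
  assumption₀ = hyp (inj₂ refl)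

  assumption₁ : ∀ {φ ψ} → Γ ,, φ ,, ψ ⊢ φ
  assumption₁ = hyp (inj₁ (inj₂ refl))

⊥̇ : Formula
⊥̇ = © var 0 ∧̇ (var 0 ∧̇ ¬̇ var 0)

⊤̇ : Formula
⊤̇ = var 0 →̇ var 0

⊥̇-elim : ∀ {Γ} γ → Γ ⊢ ⊥̇ → Γ ⊢ γ
⊥̇-elim γ ⊢⊥̇ = mp ⊢⊥̇ (ax (C1 (var 0) γ))

-- The Boolean complement of the Lindenbaum algebra; ¬̇ itself is not one.
∼ : Formula → Formula
∼ α = α →̇ ⊥̇

module Lindenbaum (Γ : FormulaSet) where

  infix 4 _≋_
  _≋_ : Formula → Formula → Set
  α ≋ β = (Γ ⊢ α →̇ β) × (Γ ⊢ β →̇ α)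

  →-trans : ∀ {α β γ} → Γ ⊢ α →̇ β → Γ ⊢ β →̇ γ → Γ ⊢ α →̇ γ
  →-trans ⊢α→β ⊢β→γ = deduction (→-elim (weaken ⊢β→γ) (→-elim (weaken ⊢α→β) assumption₀))

  ≋-refl : ∀ {α} → α ≋ α
  ≋-refl = →-refl _ , →-refl _

  ≋-sym : ∀ {α β} → α ≋ β → β ≋ α
  ≋-sym (α→β , β→α) = β→α , α→β

  ≋-trans : ∀ {α β γ} → α ≋ β → β ≋ γ → α ≋ γ
  ≋-trans (α→β , β→α) (β→γ , γ→β) = →-trans α→β β→γ , →-trans γ→β β→α

  ↔-to-≋ : ∀ {α β} → Γ ⊢ α ↔̇ β → α ≋ β
  ↔-to-≋ ⊢α↔β = ∧-elimˡ ⊢α↔β , ∧-elimʳ ⊢α↔β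

  ⊢-to-≋⊤̇ : ∀ {α} → Γ ⊢ α → α ≋ ⊤̇
  ⊢-to-≋⊤̇ ⊢α = deduction (weaken (→-refl _)) , deduction (weaken ⊢α)

  ≋⊤̇-to-⊢ : ∀ {α} → α ≋ ⊤̇ → Γ ⊢ α
  ≋⊤̇-to-⊢ (_ , ⊤̇→α) = →-elim ⊤̇→α (→-refl _)

  ∧̇-mono : ∀ {α β α′ β′} → Γ ⊢ α →̇ α′ → Γ ⊢ β →̇ β′ → Γ ⊢ α ∧̇ β →̇ α′ ∧̇ β′
  ∧̇-mono α→α′ β→β′ = deduction (∧-intro (→-elim (weaken α→α′) (∧-elimˡ assumption₀))
                                          (→-elim (weaken β→β′) (∧-elimʳ assumption₀)))

  ∨̇-mono : ∀ {α β α′ β′} → Γ ⊢ α →̇ α′ → Γ ⊢ β →̇ β′ → Γ ⊢ α ∨̇ β →̇ α′ ∨̇ β′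
  ∨̇-mono α→α′ β→β′ = deduction (∨-elim assumption₀
    (∨-introˡ _ (→-elim (weaken (weaken α→α′)) assumption₀))
    (∨-introʳ _ (→-elim (weaken (weaken β→β′)) assumption₀)))

  →̇-mono : ∀ {α β α′ β′} → Γ ⊢ α′ →̇ α → Γ ⊢ β →̇ β′ → Γ ⊢ (α →̇ β) →̇ (α′ →̇ β′)
  →̇-mono α′→α β→β′ = deduction (deduction
    (→-elim (weaken (weaken β→β′)) (→-elim assumption₁ (→-elim (weaken (weaken α′→α)) assumption₀))))

  ∧̇-cong : ∀ {α β α′ β′} → α ≋ α′ → β ≋ β′ → α ∧̇ β ≋ α′ ∧̇ β′
  ∧̇-cong (α→α′ , α′→α) (β→β′ , β′→β) = ∧̇-mono α→α′ β→β′ , ∧̇-mono α′→α β′→β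

  ∨̇-cong : ∀ {α β α′ β′} → α ≋ α′ → β ≋ β′ → α ∨̇ β ≋ α′ ∨̇ β′
  ∨̇-cong (α→α′ , α′→α) (β→β′ , β′→β) = ∨̇-mono α→α′ β→β′ , ∨̇-mono α′→α β′→β

  →̇-cong : ∀ {α β α′ β′} → α ≋ α′ → β ≋ β′ → (α →̇ β) ≋ (α′ →̇ β′)
  →̇-cong (α→α′ , α′→α) (β→β′ , β′→β) = →̇-mono α′→α β→β′ , →̇-mono α→α′ β′→β

  ∼-cong : ∀ {α α′} → α ≋ α′ → ∼ α ≋ ∼ α′
  ∼-cong α≋α′ = →̇-cong α≋α′ ≋-refl

  ∧̇-comm : ∀ α β → α ∧̇ β ≋ β ∧̇ α
  ∧̇-comm _ _ = swap , swap
    where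
      swap : ∀ {α β} → Γ ⊢ α ∧̇ β →̇ β ∧̇ α
      swap = deduction (∧-intro (∧-elimʳ assumption₀) (∧-elimˡ assumption₀))

  ∨̇-comm : ∀ α β → α ∨̇ β ≋ β ∨̇ α
  ∨̇-comm _ _ = swap , swap
    where
      swap : ∀ {α β} → Γ ⊢ α ∨̇ β →̇ β ∨̇ α
      swap = deduction (∨-elim assumption₀ (∨-introʳ _ assumption₀) (∨-introˡ _ assumption₀))

  ∧̇-assoc : ∀ α β γ → (α ∧̇ β) ∧̇ γ ≋ α ∧̇ (β ∧̇ γ)
  ∧̇-assoc _ _ _ =
    deduction (∧-intro (∧-elimˡ (∧-elimˡ assumption₀))
                       (∧-intro (∧-elimʳ (∧-elimˡ assumption₀)) (∧-elimʳ assumption₀))) ,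
    deduction (∧-intro (∧-intro (∧-elimˡ assumption₀) (∧-elimˡ (∧-elimʳ assumption₀)))
                       (∧-elimʳ (∧-elimʳ assumption₀)))

  ∨̇-assoc : ∀ α β γ → (α ∨̇ β) ∨̇ γ ≋ α ∨̇ (β ∨̇ γ)
  ∨̇-assoc _ _ _ =
    deduction (∨-elim assumption₀
      (∨-elim assumption₀ (∨-introˡ _ assumption₀) (∨-introʳ _ (∨-introˡ _ assumption₀)))
      (∨-introʳ _ (∨-introʳ _ assumption₀))) ,
    deduction (∨-elim assumption₀
      (∨-introˡ _ (∨-introˡ _ assumption₀))
      (∨-elim assumption₀ (∨-introˡ _ (∨-introʳ _ assumption₀)) (∨-introʳ _ assumption₀)))

  ∨̇-absorbs-∧̇ : ∀ α β → α ∨̇ (α ∧̇ β) ≋ α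
  ∨̇-absorbs-∧̇ _ _ =
    deduction (∨-elim assumption₀ assumption₀ (∧-elimˡ assumption₀)) ,
    deduction (∨-introˡ _ assumption₀)

  ∧̇-absorbs-∨̇ : ∀ α β → α ∧̇ (α ∨̇ β) ≋ α
  ∧̇-absorbs-∨̇ _ _ =
    deduction (∧-elimˡ assumption₀) ,
    deduction (∧-intro assumption₀ (∨-introˡ _ assumption₀))

  ∨̇-distribʳ-∧̇ : ∀ α β γ → (β ∧̇ γ) ∨̇ α ≋ (β ∨̇ α) ∧̇ (γ ∨̇ α)
  ∨̇-distribʳ-∧̇ _ _ _ =
    deduction (∨-elim assumption₀
      (∧-intro (∨-introˡ _ (∧-elimˡ assumption₀)) (∨-introˡ _ (∧-elimʳ assumption₀)))
      (∧-intro (∨-introʳ _ assumption₀) (∨-introʳ _ assumption₀))) ,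
    deduction (∨-elim (∧-elimˡ assumption₀)
      (∨-elim (∧-elimʳ assumption₁)
        (∨-introˡ _ (∧-intro assumption₁ assumption₀))
        (∨-introʳ _ assumption₀))
      (∨-introʳ _ assumption₀))

  ∨̇-complementʳ : ∀ α → α ∨̇ ∼ α ≋ ⊤̇
  ∨̇-complementʳ α = ⊢-to-≋⊤̇ (ax (P9 α ⊥̇))

  ∧̇-complementʳ : ∀ α → α ∧̇ ∼ α ≋ ⊥̇
  ∧̇-complementʳ _ =
    deduction (→-elim (∧-elimʳ assumption₀) (∧-elimˡ assumption₀)) ,
    deduction (⊥̇-elim _ assumption₀)

  isBooleanAlgebra : IsBooleanAlgebra _≋_ _∨̇_ _∧̇_ ∼ ⊤̇ ⊥̇
  isBooleanAlgebra = isBooleanAlgebraʳ record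
    { isDistributiveLattice = isDistributiveLatticeʳʲᵐ record
      { isLattice = record
        { isEquivalence = record { refl = ≋-refl ; sym = ≋-sym ; trans = ≋-trans }
        ; ∨-comm = ∨̇-comm
        ; ∨-assoc = ∨̇-assoc
        ; ∨-cong = ∨̇-cong
        ; ∧-comm = ∧̇-comm
        ; ∧-assoc = ∧̇-assoc
        ; ∧-cong = ∧̇-cong
        ; absorptive = ∨̇-absorbs-∧̇ , ∧̇-absorbs-∨̇
        }
      ; ∨-distribʳ-∧ = ∨̇-distribʳ-∧̇
      }
    ; ∨-complementʳ = ∨̇-complementʳ
    ; ∧-complementʳ = ∧̇-complementʳ
    ; ¬-cong = ∼-cong
    }

  lindenbaumAlgebra : BooleanAlgebra 0ℓ 0ℓ
  lindenbaumAlgebra = record { isBooleanAlgebra = isBooleanAlgebra }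

  ∼∨̇≋→̇ : ∀ α β → ∼ α ∨̇ β ≋ (α →̇ β)
  ∼∨̇≋→̇ α β =
    deduction (∨-elim assumption₀
      (deduction (⊥̇-elim _ (→-elim assumption₁ assumption₀)))
      (deduction assumption₁)) ,
    deduction (∨-elim (ax (P9 α ⊥̇))
      (∨-introʳ _ (→-elim assumption₁ assumption₀))
      (∨-introˡ _ assumption₀))

  ∼∨̇≋→̇-cong : ∀ {α β α′ β′} → α ≋ α′ → β ≋ β′ → ∼ α ∨̇ β ≋ (α′ →̇ β′)
  ∼∨̇≋→̇-cong α≋α′ β≋β′ = ≋-trans (∨̇-cong (∼-cong α≋α′) β≋β′) (∼∨̇≋→̇ _ _)

  ∼[α∧̇¬̇α]≋©α : ∀ α → ∼ (α ∧̇ ¬̇ α) ≋ © α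
  ∼[α∧̇¬̇α]≋©α α =
    deduction (∨-elim (ax (C2 α)) assumption₀ (⊥̇-elim _ (→-elim assumption₁ assumption₀))) ,
    deduction (deduction (mp (∧-intro assumption₁ assumption₀) (ax (C1 α ⊥̇))))

  module Canonical {c ℓ : Level} where
    open Twist (liftBooleanAlgebra c ℓ lindenbaumAlgebra) using (T; ⟦_⟧; _⊨_)

    canonical : ℕ → T
    canonical n = lift (var n) , lift (¬̇ var n)

    positive negative : Formula → Formula
    positive φ = lower (proj₁ (⟦ φ ⟧ canonical))
    negative φ = lower (proj₂ (⟦ φ ⟧ canonical))

    truth : ∀ φ → positive φ ≋ φ × negative φ ≋ ¬̇ φ
    truth (var n) = ≋-refl , ≋-refl
    truth (φ ∧̇ ψ) with truth φ | truth ψ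
    ... | φ⁺ , φ⁻ | ψ⁺ , ψ⁻ =
      ∧̇-cong φ⁺ ψ⁺ , ≋-trans (∨̇-cong φ⁻ ψ⁻) (≋-sym (↔-to-≋ (ax (DM2 φ ψ))))
    truth (φ ∨̇ ψ) with truth φ | truth ψ
    ... | φ⁺ , φ⁻ | ψ⁺ , ψ⁻ =
      ∨̇-cong φ⁺ ψ⁺ , ≋-trans (∧̇-cong φ⁻ ψ⁻) (≋-sym (↔-to-≋ (ax (DM1 φ ψ))))
    truth (φ →̇ ψ) with truth φ | truth ψ
    ... | φ⁺ , φ⁻ | ψ⁺ , ψ⁻ =
      ∼∨̇≋→̇-cong φ⁺ ψ⁺ , ≋-trans (∧̇-cong (∼∨̇≋→̇-cong φ⁻ φ⁺) ψ⁻) (≋-sym (↔-to-≋ (ax (DM3 φ ψ))))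
    truth (¬̇ φ) with truth φ
    ... | φ⁺ , φ⁻ = φ⁻ , ≋-trans φ⁺ (≋-sym (↔-to-≋ (ax (DNeg φ))))
    truth (© φ) with truth φ
    ... | φ⁺ , φ⁻ =
      ≋-trans (∼-cong (∧̇-cong φ⁺ φ⁻)) (∼[α∧̇¬̇α]≋©α φ) ,
      ≋-trans (∧̇-cong (∼∨̇≋→̇-cong φ⁺ φ⁻) (∼∨̇≋→̇-cong φ⁻ φ⁺)) (≋-sym (↔-to-≋ (ax (C3 φ))))

    complete : ∀ {α} → Γ ⊨ α → Γ ⊢ α
    complete {α} Γ⊨α = ≋⊤̇-to-⊢ (≋-trans (≋-sym (proj₁ (truth α))) (lower α⁺≋⊤̇))
      where
        α⁺≋⊤̇ = Γ⊨α canonical (λ ψ ψ∈Γ → lift (≋-trans (proj₁ (truth ψ)) (⊢-to-≋⊤̇ (hyp ψ∈Γ))))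

mainTheorem7 : {c ℓ : Level} (Γ : FormulaSet) (α : Formula) →
    ((Γ ⊢ α) → (Γ ⊨BD2[ c , ℓ ] α)) × ((Γ ⊨BD2[ c , ℓ ] α) → (Γ ⊢ α))
mainTheorem7 {c} {ℓ} Γ α =
  (λ ⊢α B → Soundness.sound B ⊢α) ,
  (λ ⊨α → Canonical.complete (⊨α (liftBooleanAlgebra c ℓ lindenbaumAlgebra)))
  where open Lindenbaum Γ
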